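{- Let $G=(V,E)$ be a finite directed graph. For an ordered pair $(s,t)$ of distinct vertices satisfying the four superbubble conditions (reachability, matching, acyclicity, minimality), let $U(s,t)$ be the set of vertices reachable from $s$ without passing through $t$, and let $\langle s,t\rangle$ be the subgraph of $G$ induced by $U(s,t)$. Then the map $(s,t)\mapsto \langle s,t\rangle$ from the set of such pairs to the set of superbubbles of $G$ is a bijection; that is, if $(s_1,t_1)\neq(s_2,t_2)$ are two such pairs, then $\langle s_1,t_1\rangle\neq\langle s_2,t_2\rangle$.
   Context: "Passing through" a vertex means visiting it and then leaving it (not merely arriving at it or merely starting from it); thus, e.g., $t$ itself is reachable from $s$ without passing through $t$. Superbubble definition: an ordered pair of distinct vertices $(s,t)$ of $G$ satisfies the superbubble conditions if: (reachability) $t$ is reachable from $s$; (matching) the set $U$ of vertices reachable from $s$ without passing through $t$ equals the set of vertices from which $t$ is reachable without passing through $s$; (acyclicity) the subgraph of $G$ induced by $U$ is acyclic; (minimality) no vertex of $U$ other than $t$ forms, together with $s$ (as the pair $(s,v)$), a pair satisfying the reachability, matching and acyclicity conditions. For such a pair, the subgraph induced by $U$ is called a superbubble, denoted $\langle s,t\rangle$, with entrance $s$, exit $t$, and interior $U\setminus\{s,t\}$. -}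

module Defs where

open import Data.Nat using (ℕ)
open import Data.Fin using (Fin)
open import Data.Bool using (Bool; T)
open import Data.Product using (_×_; Σ-syntax; ∃-syntax)
open import Relation.Binary.PropositionalEquality using (_≡_; _≢_)
open import Relation.Nullary using (¬_)
open import Function.Bundles using (_⇔_)

record Digraph : Set where
  field
    n   : ℕ
    adj : Fin n → Fin n → Bool

module _ (G : Digraph) where
  open Digraph G

  Vertex : Set
  Vertex = Fin n

  Edge : Vertex → Vertex → Set
  Edge u v = T (adj u v)

  -- ReachAvoid x u v : there is a walk u = v₀ → v₁ → … → vₖ = v (k ≥ 0)
  -- none of whose intermediate vertices v₁ … vₖ₋₁ equals x,
  -- i.e. v is reachable from u without passing through x.
  data ReachAvoid (x : Vertex) : Vertex → Vertex → Set where
    stay : ∀ {u} → ReachAvoid x u u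
    edge : ∀ {u v} → Edge u v → ReachAvoid x u v
    step : ∀ {u w v} → Edge u w → w ≢ x → ReachAvoid x w v → ReachAvoid x u v

  data Reach : Vertex → Vertex → Set where
    stay : ∀ {u} → Reach u u
    step : ∀ {u w v} → Edge u w → Reach w v → Reach u v

  U : Vertex → Vertex → Vertex → Set
  U s t v = ReachAvoid t s v

  data Walk⁺ (P : Vertex → Set) : Vertex → Vertex → Set where
    one  : ∀ {u v} → P u → P v → Edge u v → Walk⁺ P u v
    cons : ∀ {u w v} → P u → Edge u w → Walk⁺ P w v → Walk⁺ P u v

  InducedAcyclic : (Vertex → Set) → Set
  InducedAcyclic P = ∀ u → ¬ Walk⁺ P u u

  ReachabilityCond : Vertex → Vertex → Set
  ReachabilityCond s t = Reach s t

  MatchingCond : Vertex → Vertex → Set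
  MatchingCond s t = ∀ v → (ReachAvoid t s v ⇔ ReachAvoid s v t)

  AcyclicityCond : Vertex → Vertex → Set
  AcyclicityCond s t = InducedAcyclic (U s t)

  PreSuperbubble : Vertex → Vertex → Set
  PreSuperbubble s t =
    s ≢ t × ReachabilityCond s t × MatchingCond s t × AcyclicityCond s t

  MinimalityCond : Vertex → Vertex → Set
  MinimalityCond s t = ∀ v → U s t v → v ≢ t → ¬ PreSuperbubble s v

  IsSuperbubblePair : Vertex → Vertex → Set
  IsSuperbubblePair s t = PreSuperbubble s t × MinimalityCond s t

  record Subgraph : Set₁ where
    field
      vert : Vertex → Set
      edg  : Vertex → Vertex → Set

  induced : (Vertex → Set) → Subgraph
  induced P = record { vert = P ; edg = λ u v → P u × P v × Edge u v }

  SameSubgraph : Subgraph → Subgraph → Set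
  SameSubgraph H K =
    (∀ v → Subgraph.vert H v ⇔ Subgraph.vert K v) ×
    (∀ u v → Subgraph.edg H u v ⇔ Subgraph.edg K u v)

  superbubble : Vertex → Vertex → Subgraph
  superbubble s t = induced (U s t)

module Submission where

-- Suppose the superbubble pairs (s₁,t₁) and (s₂,t₂) have the same vertex
-- set U = U(s₁,t₁) = U(s₂,t₂); we show (s₁,t₁) = (s₂,t₂).
--
-- Entrances.  Every vertex of U(s,t) other than s is the end of a non-empty
-- walk from s inside U(s,t) (a walk from s avoiding t stays in U(s,t)).
-- If s₁ ≠ s₂, then s₂ ∈ U₂ = U₁ and s₁ ∈ U₁ = U₂, so U contains a walk
-- s₁ ⇝ s₂ and a walk s₂ ⇝ s₁; together they form a cycle in U, contrary to
-- acyclicity.  Hence s₁ = s₂.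
--
-- Exits.  By matching, the exit t₂ lies in U(s₂,t₂) = U(s₁,t₁).  If t₂ ≠ t₁,
-- the pre-superbubble (s₁,t₂) would violate the minimality of (s₁,t₁).

open import Defs
open import Data.Product using (_,_; proj₁)
open import Data.Sum using (_⊎_; inj₁; inj₂)
open import Data.Empty using (⊥; ⊥-elim)
open import Data.Fin using (_≟_)
open import Relation.Binary.PropositionalEquality using (_≡_; _≢_; refl; sym)
open import Relation.Nullary using (¬_; yes; no)
open import Function.Bundles using (_⇔_; Equivalence)

module _ (G : Digraph) where

  walk-++ : ∀ {P u v w} → Walk⁺ G P u v → Walk⁺ G P v w → Walk⁺ G P u w
  walk-++ (one pu pv e) W = cons pu e W
  walk-++ (cons pu e W) W' = cons pu e (walk-++ W W')

  walk-mono : ∀ {P Q : Vertex G → Set} → (∀ x → P x → Q x) →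
              ∀ {u v} → Walk⁺ G P u v → Walk⁺ G Q u v
  walk-mono P⊆Q (one pu pv e) = one (P⊆Q _ pu) (P⊆Q _ pv) e
  walk-mono P⊆Q (cons pu e W) = cons (P⊆Q _ pu) e (walk-mono P⊆Q W)

  no-mutual-walks : ∀ {P u v} → InducedAcyclic G P →
                    Walk⁺ G P u v → Walk⁺ G P v u → ⊥
  no-mutual-walks acyclic W W' = acyclic _ (walk-++ W W')

  U-step : ∀ {s t x y} → U G s t x → x ≢ t → Edge G x y → U G s t y
  U-step stay             x≢t e = edge e
  U-step (edge e′)         x≢t e = step e′ x≢t (edge e)
  U-step (step e′ w≢t r)   x≢t e = step e′ w≢t (U-step r x≢t e)

  avoiding-walk-in-U : ∀ {s t u v} → U G s t u → u ≢ t →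
                       ReachAvoid G t u v → u ≡ v ⊎ Walk⁺ G (U G s t) u v
  avoiding-walk-in-U hu u≢t stay = inj₁ refl
  avoiding-walk-in-U hu u≢t (edge e) = inj₂ (one hu (U-step hu u≢t e) e)
  avoiding-walk-in-U hu u≢t (step e w≢t r)
    with avoiding-walk-in-U (U-step hu u≢t e) w≢t r
  ... | inj₁ refl = inj₂ (one hu (U-step hu u≢t e) e)
  ... | inj₂ W    = inj₂ (cons hu e W)

  walk-from-entrance : ∀ {s t v} → s ≢ t → U G s t v → s ≢ v →
                       Walk⁺ G (U G s t) s v
  walk-from-entrance s≢t hv s≢v with avoiding-walk-in-U stay s≢t hv
  ... | inj₁ s≡v = ⊥-elim (s≢v s≡v)
  ... | inj₂ W   = W

  exit-in-U : ∀ {s t} → MatchingCond G s t → U G s t t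
  exit-in-U matching = Equivalence.from (matching _) stay

  SameU : Vertex G → Vertex G → Vertex G → Vertex G → Set
  SameU s₁ t₁ s₂ t₂ = ∀ v → U G s₁ t₁ v ⇔ U G s₂ t₂ v

  same-entrance : ∀ {s₁ t₁ s₂ t₂} →
                  PreSuperbubble G s₁ t₁ → PreSuperbubble G s₂ t₂ →
                  SameU s₁ t₁ s₂ t₂ → s₁ ≡ s₂
  same-entrance {s₁} {t₁} {s₂} {t₂} (s₁≢t₁ , _ , _ , acyclic₁) (s₂≢t₂ , _ , _ , _) sameU
    with s₁ ≟ s₂
  ... | yes s₁≡s₂ = s₁≡s₂
  ... | no  s₁≢s₂ = ⊥-elim (no-mutual-walks acyclic₁ s₁⇝s₂ s₂⇝s₁)
    where
    s₁⇝s₂ : Walk⁺ G (U G s₁ t₁) s₁ s₂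
    s₁⇝s₂ = walk-from-entrance s₁≢t₁ (Equivalence.from (sameU s₂) stay) s₁≢s₂

    s₂⇝s₁ : Walk⁺ G (U G s₁ t₁) s₂ s₁
    s₂⇝s₁ = walk-mono (λ x → Equivalence.from (sameU x))
              (walk-from-entrance s₂≢t₂ (Equivalence.to (sameU s₁) stay)
                                  (λ s₂≡s₁ → s₁≢s₂ (sym s₂≡s₁)))

  same-exit : ∀ {s t₁ t₂} → IsSuperbubblePair G s t₁ → PreSuperbubble G s t₂ →
              U G s t₁ t₂ → t₁ ≡ t₂
  same-exit {t₁ = t₁} {t₂} (_ , minimal) pre t₂∈U with t₁ ≟ t₂
  ... | yes t₁≡t₂ = t₁≡t₂
  ... | no  t₁≢t₂ = ⊥-elim (minimal t₂ t₂∈U (λ t₂≡t₁ → t₁≢t₂ (sym t₂≡t₁)) pre)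

  pair-determined-by-U : ∀ {s₁ t₁ s₂ t₂} →
                         IsSuperbubblePair G s₁ t₁ → IsSuperbubblePair G s₂ t₂ →
                         SameU s₁ t₁ s₂ t₂ → (s₁ , t₁) ≡ (s₂ , t₂)
  pair-determined-by-U sb₁@(pre₁ , _) (pre₂@(_ , _ , matching₂ , _) , _) sameU
    with same-entrance pre₁ pre₂ sameU
  ... | refl with same-exit sb₁ pre₂ (Equivalence.from (sameU _) (exit-in-U matching₂))
  ...   | refl = refl

mainTheorem1 : (G : Digraph) → ∀ s₁ t₁ s₂ t₂ →
    IsSuperbubblePair G s₁ t₁ → IsSuperbubblePair G s₂ t₂ →
    (s₁ , t₁) ≢ (s₂ , t₂) →
    ¬ SameSubgraph G (superbubble G s₁ t₁) (superbubble G s₂ t₂)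
mainTheorem1 G s₁ t₁ s₂ t₂ sb₁ sb₂ distinct same =
  distinct (pair-determined-by-U G sb₁ sb₂ (proj₁ same))
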